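{- Let $n,m,k$ be positive integers with $m<n\le km$, let $t=\lfloor (km-n)/m\rfloor$, $a=n-(k-t-2)m$, and suppose $h=\max\{\lfloor a/2^{t+1}\rfloor,1\}>1$. Let $S\subseteq\{1,\dots,m\}$ with $|S|\ge m-h+2$. Then there exist $t+2$ elements $s_0<s_1<\dots<s_{t+1}$ of $S$ such that for every $1\le j\le t+1$, $$s_0+(2^{j-1}-1)h+1\le s_j\le 2^{j-1}h\quad\text{and}\quad s_j>\sum_{i=0}^{j-1}s_i.$$ -}

module Defs where

open import Data.Nat using (ℕ; _+_; _*_; _∸_; _^_; _⊔_; _/_)
open import Data.List using (List; map; upTo)
open import Data.Nat.Properties using (m^n≢0)
open import Data.Nat.ListAction using (sum)

-- t = ⌊(km - n)/m⌋  (hypothesis n ≤ km makes the subtraction exact; m > 0)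
tOf : (n m k : ℕ) → ℕ
tOf n m k = ((k * m) ∸ n) / (1 + (m ∸ 1))

-- a = n - (k - t - 2) m   (under m < n ≤ km one has 0 ≤ k-t-2 and a > 0)
aOf : (n m k : ℕ) → ℕ
aOf n m k = n ∸ ((k ∸ (tOf n m k + 2)) * m)

hOf : (n m k : ℕ) → ℕ
hOf n m k = (_/_ (aOf n m k) (2 ^ (tOf n m k + 1)) {{m^n≢0 2 (tOf n m k + 1)}}) ⊔ 1

sumBelow : (ℕ → ℕ) → ℕ → ℕ
sumBelow s j = sum (map s (upTo j))

{-# OPTIONS --safe #-}
-- Let μ = min S and, for j ≤ t, consider the window [μ + (2^j - 1)h + 1, 2^j h] inside [μ, m]
-- (it fits: tm ≤ km - n gives a ≤ 2m, and 2^(t+1) h ≤ a since h > 1). If S missed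
-- the window, S would lie in [μ, μ + (2^j - 1)h] ∪ (2^j h, m], a set of only m - h + 1
-- points; so every window contains some s_{j+1} ∈ S. The windows are increasing, and the
-- sum s_0 + … + s_j is at most μ + (2^j - 1)h, which lies just below the next window.
module Submission where

open import Defs
open import Data.Nat using (ℕ; _+_; _*_; _∸_; _^_; _≤_; _<_; zero; suc; z≤n; s≤s; s≤s⁻¹; z<s; _⊔_; _≤?_; _/_)
open import Data.Nat.Properties
open import Data.Nat.DivMod using (m/n*n≤m)
open import Data.Nat.ListAction using (sum)
open import Data.Nat.ListAction.Properties using (sum-++)
open import Data.Nat.Tactic.RingSolver using (solve-∀)
open import Data.List using (List; []; _∷_; [_]; _++_; _∷ʳ_; length; map; applyUpTo; upTo)
open import Data.List.Properties using (length-++; length-applyUpTo; length-removeAt′; map-++; applyUpTo-∷ʳ)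
open import Data.List.Extrema.Nat using (min; min≤⊤; min≤xs; argmin-sel)
open import Data.List.Relation.Unary.All as All using (All; _∷_)
open import Data.List.Relation.Unary.Any using (Any; here; there; any?; index; _─_)
open import Data.List.Relation.Unary.Unique.Propositional using (Unique)
open import Data.List.Relation.Unary.AllPairs using (_∷_)
open import Data.List.Relation.Binary.Subset.Propositional using (_⊆_)
open import Data.List.Membership.Propositional using (_∈_; find; lose)
open import Data.List.Membership.Propositional.Properties using (∈-applyUpTo⁺; ∈-++⁺ˡ; ∈-++⁺ʳ)
open import Data.Product using (Σ; ∃; ∃-syntax; _×_; _,_; proj₁; proj₂)
open import Data.Sum using ([_,_]′)
open import Function using (id; _∘′_)
open import Level using (Level)
open import Relation.Nullary using (yes; no; contradiction)
open import Relation.Nullary.Decidable using (_×-dec_)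
open import Relation.Binary.PropositionalEquality using (_≡_; _≢_; refl; sym; trans; cong; cong₂; subst; module ≡-Reasoning)

private
  variable
    a : Level
    A : Set a

∈-─ : ∀ {x y : A} {ys} (x∈ys : x ∈ ys) → y ∈ ys → x ≢ y → y ∈ (ys ─ x∈ys)
∈-─ (here refl)  (here refl)  x≢y = contradiction refl x≢y
∈-─ (here refl)  (there y∈ys) _   = y∈ys
∈-─ (there x∈ys) (here refl)  _   = here refl
∈-─ (there x∈ys) (there y∈ys) x≢y = there (∈-─ x∈ys y∈ys x≢y)

Unique∧⊆⇒length≤ : ∀ {xs ys : List A} → Unique xs → xs ⊆ ys → length xs ≤ length ys
Unique∧⊆⇒length≤ {xs = []}     _             _      = z≤n
Unique∧⊆⇒length≤ {xs = x ∷ xs} {ys} (x∉xs ∷ u) xs⊆ys = begin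
  suc (length xs)          ≤⟨ s≤s (Unique∧⊆⇒length≤ u xs⊆ys─x) ⟩
  suc (length (ys ─ x∈ys)) ≡⟨ sym (length-removeAt′ ys (index x∈ys)) ⟩
  length ys                ∎
  where
  open ≤-Reasoning
  x∈ys : x ∈ ys
  x∈ys = xs⊆ys (here refl)
  xs⊆ys─x : xs ⊆ (ys ─ x∈ys)
  xs⊆ys─x y∈xs = ∈-─ x∈ys (xs⊆ys (there y∈xs)) (All.lookup x∉xs y∈xs)

interval : ℕ → ℕ → List ℕ
interval a b = applyUpTo (a +_) (b ∸ a)

∈-interval : ∀ {a b z} → a ≤ z → z < b → z ∈ interval a b
∈-interval {a} {b} a≤z z<b =
  subst (_∈ interval a b) (m+[n∸m]≡n a≤z) (∈-applyUpTo⁺ (a +_) (∸-monoˡ-< z<b a≤z))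

length-interval : ∀ a b → length (interval a b) ≡ b ∸ a
length-interval a b = length-applyUpTo (a +_) (b ∸ a)

window-hit : ∀ {μ m lo hi} {S : List ℕ} → Unique S → All (λ z → μ ≤ z × z ≤ m) S →
             (lo ∸ μ) + (m ∸ hi) < length S → Any (λ z → lo ≤ z × z ≤ hi) S
window-hit {μ} {m} {lo} {hi} {S} u bounds large with any? (λ z → lo ≤? z ×-dec z ≤? hi) S
... | yes hit  = hit
... | no  miss = contradiction (Unique∧⊆⇒length≤ u S⊆outside)
                   (<⇒≱ (subst (_< length S) (sym length-outside) large))
  where
  outside : List ℕ
  outside = interval μ lo ++ interval (suc hi) (suc m)
  length-outside : length outside ≡ (lo ∸ μ) + (m ∸ hi)
  length-outside = trans (length-++ (interval μ lo))
                         (cong₂ _+_ (length-interval μ lo) (length-interval (suc hi) (suc m)))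
  S⊆outside : S ⊆ outside
  S⊆outside {z} z∈S with All.lookup bounds z∈S | lo ≤? z
  ... | μ≤z , _   | no lo≰z = ∈-++⁺ˡ (∈-interval μ≤z (≰⇒> lo≰z))
  ... | _   , z≤m | yes lo≤z =
    ∈-++⁺ʳ (interval μ lo) (∈-interval (≰⇒> λ z≤hi → miss (lose z∈S (lo≤z , z≤hi))) (s≤s z≤m))

sumBelow-suc : ∀ s n → sumBelow s (suc n) ≡ sumBelow s n + s n
sumBelow-suc s n = begin
  sum (map s (upTo (suc n)))         ≡⟨ cong (sum ∘′ map s) (sym (applyUpTo-∷ʳ id n)) ⟩
  sum (map s (upTo n ∷ʳ n))          ≡⟨ cong sum (map-++ s (upTo n) [ n ]) ⟩
  sum (map s (upTo n) ++ [ s n ])    ≡⟨ sum-++ (map s (upTo n)) [ s n ] ⟩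
  sumBelow s n + (s n + 0)           ≡⟨ cong (sumBelow s n +_) (+-identityʳ (s n)) ⟩
  sumBelow s n + s n                 ∎
  where open ≡-Reasoning

gap-count< : ∀ {P h m L} → 1 ≤ P → P * h ≤ m → m + 2 ≤ L + h → (P ∸ 1) * h + 1 + (m ∸ P * h) < L
gap-count< {suc p} {h} {m} {L} _ Ph≤m large = +-cancelʳ-< h _ L (begin-strict
  p * h + 1 + (m ∸ (h + p * h)) + h    ≡⟨ rearrange p h (m ∸ (h + p * h)) ⟩
  suc (h + p * h + (m ∸ (h + p * h)))  ≡⟨ cong suc (m+[n∸m]≡n Ph≤m) ⟩
  suc m                                <⟨ n<1+n (suc m) ⟩
  suc (suc m)                          ≡⟨ +-comm 2 m ⟩
  m + 2                                ≤⟨ large ⟩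
  L + h                                ∎)
  where
  open ≤-Reasoning
  rearrange : ∀ p h r → p * h + 1 + r + h ≡ suc (h + p * h + r)
  rearrange = solve-∀

sum-doubling : ∀ μ P h → 1 ≤ P → μ + (P ∸ 1) * h + P * h ≡ μ + (2 * P ∸ 1) * h
sum-doubling μ (suc p) h _ = identity μ p h
  where
  identity : ∀ μ p h → μ + p * h + suc p * h ≡ μ + (p + suc (p + 0)) * h
  identity = solve-∀

DoublingChain : List ℕ → (t h : ℕ) → (ℕ → ℕ) → Set
DoublingChain S t h s =
  (∀ i → i ≤ t + 1 → s i ∈ S) ×
  (∀ i j → i < j → j ≤ t + 1 → s i < s j) ×
  (∀ j → 1 ≤ j → j ≤ t + 1 →
    (s 0 + ((2 ^ (j ∸ 1)) ∸ 1) * h + 1 ≤ s j) ×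
    (s j ≤ (2 ^ (j ∸ 1)) * h) ×
    (sumBelow s j < s j))

1+j≤t+1⇒j≤t : ∀ {j t} → suc j ≤ t + 1 → j ≤ t
1+j≤t+1⇒j≤t {j} {t} le = s≤s⁻¹ (≤-trans le (≤-reflexive (+-comm t 1)))

module DoublingChainConstruction {m h t : ℕ} (fits : 2 ^ t * h ≤ m) {x : ℕ} {xs : List ℕ}
  (u : Unique (x ∷ xs)) (≤m : All (_≤ m) (x ∷ xs)) (large : m + 2 ≤ length (x ∷ xs) + h) where

  S : List ℕ
  S = x ∷ xs

  μ : ℕ
  μ = min x xs

  μ∈S : μ ∈ S
  μ∈S = [ here , there ]′ (argmin-sel id x xs)

  μ≤S : All (μ ≤_) S
  μ≤S = min≤⊤ x xs ∷ min≤xs x xs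

  lo hi : ℕ → ℕ
  lo j = μ + (2 ^ j ∸ 1) * h + 1
  hi j = 2 ^ j * h

  <lo : ∀ j → μ + (2 ^ j ∸ 1) * h < lo j
  <lo j = m<m+n _ z<s

  hit : ∀ j → j ≤ t → ∃[ y ] y ∈ S × lo j ≤ y × y ≤ hi j
  hit j j≤t = find (window-hit u (All.zip (μ≤S , ≤m)) count)
    where
    lo∸μ : lo j ∸ μ ≡ (2 ^ j ∸ 1) * h + 1
    lo∸μ = trans (cong (_∸ μ) (+-assoc μ _ 1)) (m+n∸m≡n μ _)
    count : (lo j ∸ μ) + (m ∸ hi j) < length S
    count = subst (λ w → w + (m ∸ hi j) < length S) (sym lo∸μ)
              (gap-count< (m^n>0 2 j) (≤-trans (*-monoˡ-≤ h (^-monoʳ-≤ 2 j≤t)) fits) large)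

  s : ℕ → ℕ
  s zero = μ
  s (suc j) with j ≤? t
  ... | yes j≤t = proj₁ (hit j j≤t)
  ... | no  _   = μ

  s-hit : ∀ j → j ≤ t → s (suc j) ∈ S × lo j ≤ s (suc j) × s (suc j) ≤ hi j
  s-hit j j≤t with j ≤? t
  ... | yes j≤t′ = proj₂ (hit j j≤t′)
  ... | no  j≰t  = contradiction j≤t j≰t

  s∈S : ∀ i → i ≤ t + 1 → s i ∈ S
  s∈S zero    _  = μ∈S
  s∈S (suc j) le = proj₁ (s-hit j (1+j≤t+1⇒j≤t le))

  lo≤s : ∀ j → j ≤ t → lo j ≤ s (suc j)
  lo≤s j j≤t = proj₁ (proj₂ (s-hit j j≤t))

  s≤hi : ∀ j → j ≤ t → s (suc j) ≤ hi j
  s≤hi j j≤t = proj₂ (proj₂ (s-hit j j≤t))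

  s-increasing : ∀ i j → i < j → j ≤ t + 1 → s i < s j
  s-increasing zero (suc j) _ le =
    ≤-<-trans (m≤m+n μ _) (<-≤-trans (<lo j) (lo≤s j (1+j≤t+1⇒j≤t le)))
  s-increasing (suc i) (suc j) (s≤s i<j) le = begin-strict
    s (suc i)              ≤⟨ s≤hi i (≤-trans (n≤1+n i) (≤-trans i<j j≤t)) ⟩
    2 ^ i * h              ≤⟨ *-monoˡ-≤ h (<⇒≤pred (^-monoʳ-< 2 (s≤s (s≤s z≤n)) i<j)) ⟩
    (2 ^ j ∸ 1) * h        ≤⟨ m≤n+m _ μ ⟩
    μ + (2 ^ j ∸ 1) * h    <⟨ <lo j ⟩
    lo j                   ≤⟨ lo≤s j j≤t ⟩
    s (suc j)              ∎
    where
    open ≤-Reasoning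
    j≤t : j ≤ t
    j≤t = 1+j≤t+1⇒j≤t le

  sumBelow≤ : ∀ j → j ≤ t → sumBelow s (suc j) ≤ μ + (2 ^ j ∸ 1) * h
  sumBelow≤ zero    _     = ≤-refl
  sumBelow≤ (suc j) 1+j≤t = begin
    sumBelow s (suc (suc j))               ≡⟨ sumBelow-suc s (suc j) ⟩
    sumBelow s (suc j) + s (suc j)         ≤⟨ +-mono-≤ (sumBelow≤ j j≤t) (s≤hi j j≤t) ⟩
    μ + (2 ^ j ∸ 1) * h + 2 ^ j * h        ≡⟨ sum-doubling μ (2 ^ j) h (m^n>0 2 j) ⟩
    μ + (2 ^ suc j ∸ 1) * h                ∎
    where
    open ≤-Reasoning
    j≤t : j ≤ t
    j≤t = ≤-trans (n≤1+n j) 1+j≤t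

  s-bounds : ∀ j → 1 ≤ j → j ≤ t + 1 →
    (s 0 + ((2 ^ (j ∸ 1)) ∸ 1) * h + 1 ≤ s j) ×
    (s j ≤ (2 ^ (j ∸ 1)) * h) ×
    (sumBelow s j < s j)
  s-bounds (suc j) _ le = lo≤s j j≤t , s≤hi j j≤t ,
    ≤-<-trans (sumBelow≤ j j≤t) (<-≤-trans (<lo j) (lo≤s j j≤t))
    where
    j≤t : j ≤ t
    j≤t = 1+j≤t+1⇒j≤t le

doubling-chain : ∀ {m h t} (S : List ℕ) → 2 ^ t * h ≤ m → Unique S → All (_≤ m) S →
                 m + 2 ≤ length S + h → ∃ (DoublingChain S t h)
doubling-chain {m} {h} {t} [] fits _ _ large =
  contradiction (≤-trans large (≤-trans (m≤n*m h (2 ^ t) {{m^n≢0 2 t}}) fits)) (m+1+n≰m m)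
doubling-chain {t = t} (x ∷ xs) fits u ≤m large = s , s∈S , s-increasing , s-bounds
  where open DoublingChainConstruction {t = t} fits u ≤m large

1<m⊔1⇒m⊔1≡m : ∀ {m} → 1 < m ⊔ 1 → m ⊔ 1 ≡ m
1<m⊔1⇒m⊔1≡m {zero}  (s≤s ())
1<m⊔1⇒m⊔1≡m {suc m} _ = cong suc (⊔-identityʳ m)

n+t*m≤k*m : ∀ {n m k} → 1 ≤ m → n ≤ k * m → n + tOf n m k * m ≤ k * m
n+t*m≤k*m {n} {m@(suc _)} {k} _ n≤km = begin
  n + tOf n m k * m  ≤⟨ +-monoʳ-≤ n (m/n*n≤m (k * m ∸ n) m) ⟩
  n + (k * m ∸ n)    ≡⟨ m+[n∸m]≡n n≤km ⟩
  k * m              ∎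
  where open ≤-Reasoning

aOf≤2*m : ∀ {n m k} → 1 ≤ m → n ≤ k * m → aOf n m k ≤ 2 * m
aOf≤2*m {n} {m} {k} 1≤m n≤km = m≤n+o⇒m∸n≤o n (K * m) (begin
  n                  ≤⟨ m+n≤o⇒m≤o∸n n (n+t*m≤k*m {k = k} 1≤m n≤km) ⟩
  k * m ∸ t * m      ≡⟨ sym (*-distribʳ-∸ m k t) ⟩
  (k ∸ t) * m        ≤⟨ *-monoˡ-≤ m k∸t≤2+K ⟩
  (2 + K) * m        ≡⟨ *-distribʳ-+ m 2 K ⟩
  2 * m + K * m      ≡⟨ +-comm (2 * m) (K * m) ⟩
  K * m + 2 * m      ∎)
  where
  open ≤-Reasoning
  t K : ℕ
  t = tOf n m k
  K = k ∸ (t + 2)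
  k∸t≤2+K : k ∸ t ≤ 2 + K
  k∸t≤2+K = subst (λ r → k ∸ t ≤ 2 + r) (∸-+-assoc k t 2) (m≤n+m∸n (k ∸ t) 2)

2^t*h≤m : ∀ {n m k} → 1 ≤ m → n ≤ k * m → 1 < hOf n m k → 2 ^ tOf n m k * hOf n m k ≤ m
2^t*h≤m {n} {m} {k} 1≤m n≤km 1<h = *-cancelˡ-≤ 2 (begin
  2 * (2 ^ t * h)    ≡⟨ sym (*-assoc 2 (2 ^ t) h) ⟩
  2 ^ suc t * h      ≡⟨ *-comm (2 ^ suc t) h ⟩
  h * 2 ^ suc t      ≡⟨ cong (λ e → h * 2 ^ e) (+-comm 1 t) ⟩
  h * 2 ^ (t + 1)    ≡⟨ cong (_* 2 ^ (t + 1)) (1<m⊔1⇒m⊔1≡m 1<h) ⟩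
  q * 2 ^ (t + 1)    ≤⟨ m/n*n≤m (aOf n m k) (2 ^ (t + 1)) {{m^n≢0 2 (t + 1)}} ⟩
  aOf n m k          ≤⟨ aOf≤2*m 1≤m n≤km ⟩
  2 * m              ∎)
  where
  open ≤-Reasoning
  t h q : ℕ
  t = tOf n m k
  h = hOf n m k
  q = _/_ (aOf n m k) (2 ^ (t + 1)) {{m^n≢0 2 (t + 1)}}

lemma4p11 : (n m k : ℕ) → 1 ≤ n → 1 ≤ m → 1 ≤ k → m < n → n ≤ k * m →
    1 < hOf n m k →
    (S : List ℕ) → Unique S → All (λ x → 1 ≤ x × x ≤ m) S →
    m + 2 ≤ length S + hOf n m k →
    Σ (ℕ → ℕ) λ s →
      (∀ i → i ≤ tOf n m k + 1 → s i ∈ S) ×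
      (∀ i j → i < j → j ≤ tOf n m k + 1 → s i < s j) ×
      (∀ j → 1 ≤ j → j ≤ tOf n m k + 1 →
        (s 0 + ((2 ^ (j ∸ 1)) ∸ 1) * hOf n m k + 1 ≤ s j) ×
        (s j ≤ (2 ^ (j ∸ 1)) * hOf n m k) ×
        (sumBelow s j < s j))
lemma4p11 n m k _ 1≤m _ _ n≤km 1<h S u bounds large =
  doubling-chain S (2^t*h≤m 1≤m n≤km 1<h) u (All.map proj₂ bounds) large
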